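{- Let $D$ be a digraph. Then $\langle D\rangle$ is $\mathscr{L}$-trivial if and only if (i) every vertex of $D$ has out-degree at most $1$, and (ii) $D$ contains no directed cycle of length greater than $2$.
   Context: For $a\neq b$ in $\{1,\ldots,n\}$, $(a\to b)$ denotes the transformation mapping $a$ to $b$ and fixing every other point; transformations are composed left to right. For a digraph $D$ on $\{1,\ldots,n\}$ (no loops, no multiple arcs), $\langle D\rangle$ is the semigroup generated by all $(a\to b)$ with $(a,b)$ an arc. A directed cycle of length $r$ is a walk $v_0,v_1,\ldots,v_r$ along arcs with $v_0=v_r$ and all other vertices distinct. A semigroup is $\mathscr{L}$-trivial if any two elements related by Green's $\mathscr{L}$-relation are equal. -}

module Defs where

open import Data.Nat using (ℕ; zero; suc; _≤_; _<_)
open import Data.Fin using (Fin; zero; suc; inject₁; fromℕ; _≟_)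
open import Data.Bool using (Bool; true; false; if_then_else_)
open import Data.List using (List; map; allFin)
open import Data.Nat.ListAction using (sum)
open import Data.Product using (Σ; _×_; _,_)
open import Data.Sum using (_⊎_)
open import Relation.Nullary using (¬_; does)
open import Relation.Binary.PropositionalEquality using (_≡_)

-- A digraph on vertex set {1..n} (modelled as Fin n): arc relation as a
-- Bool-valued function, with no loops. (No multiple arcs is automatic.)
record Digraph (n : ℕ) : Set where
  field
    arc      : Fin n → Fin n → Bool
    loopless : ∀ a → arc a a ≡ false
open Digraph public

Arc : ∀ {n} → Digraph n → Fin n → Fin n → Set
Arc D a b = arc D a b ≡ true

Trans : ℕ → Set
Trans n = Fin n → Fin n

_≈_ : ∀ {n} → Trans n → Trans n → Set
f ≈ g = ∀ x → f x ≡ g x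

-- Composition, left to right: (f · g) x = g (f x)  (first f, then g).
_·_ : ∀ {n} → Trans n → Trans n → Trans n
(f · g) x = g (f x)

elem : ∀ {n} → Fin n → Fin n → Trans n
elem a b x = if does (x ≟ a) then b else x

data ⟨_⟩∋_ {n : ℕ} (D : Digraph n) : Trans n → Set where
  gen  : ∀ {a b} → Arc D a b → ⟨ D ⟩∋ elem a b
  comp : ∀ {f g} → ⟨ D ⟩∋ f → ⟨ D ⟩∋ g → ⟨ D ⟩∋ (f · g)
  resp : ∀ {f g} → f ≈ g → ⟨ D ⟩∋ f → ⟨ D ⟩∋ g

-- s ∈ S¹ t  (for S = ⟨D⟩):  s = t or s = u t with u ∈ S.
InLeftIdeal¹ : ∀ {n} → Digraph n → Trans n → Trans n → Set
InLeftIdeal¹ D s t = s ≈ t ⊎ Σ (Trans _) (λ u → ⟨ D ⟩∋ u × s ≈ (u · t))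

GreenL : ∀ {n} → Digraph n → Trans n → Trans n → Set
GreenL D s t = InLeftIdeal¹ D s t × InLeftIdeal¹ D t s

LTrivial : ∀ {n} → Digraph n → Set
LTrivial D = ∀ s t → ⟨ D ⟩∋ s → ⟨ D ⟩∋ t → GreenL D s t → s ≈ t

outDegree : ∀ {n} → Digraph n → Fin n → ℕ
outDegree {n} D a = sum (map (λ b → if arc D a b then 1 else 0) (allFin n))

record DirectedCycle {n : ℕ} (D : Digraph n) (r : ℕ) : Set where
  field
    v        : Fin (suc r) → Fin n
    arcs     : ∀ (i : Fin r) → Arc D (v (inject₁ i)) (v (suc i))
    closed   : v zero ≡ v (fromℕ r)
    distinct : ∀ (i j : Fin r) → v (inject₁ i) ≡ v (inject₁ j) → i ≡ j

module Submission where

-- Two arcs a → b, a → c make the generators (a→b), (a→c)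
-- L-related, so L-triviality forces b = c.  On a cycle of length ≥ 3, products
-- of "collapses" (maps dragging an initial segment of a path onto its next
-- vertex) give two distinct L-related elements (module LongCycle).
--
-- In a functional digraph every f ∈ ⟨D⟩
-- moves each point forward along its unique walk.  Fix x and write y ≼ z when
-- the walk from x visits y no later than z.  Every generator, hence every
-- f ∈ ⟨D⟩, is monotone for ≼; the absence of long cycles is used exactly
-- once, to see that a step a → b leading back along the walk closes a
-- 2-cycle.  If s = u t then x ≼ u x gives t x ≼ s x by monotonicity of t;
-- if also t = u' s then s x ≼ t x, and ≼ is antisymmetric, so s = t.

open import Defs
open import Data.Nat using (ℕ; zero; suc; pred; _+_; _∸_; _≤_; _<_; z≤n; s≤s)
open import Data.Nat.Properties
  using (≤-refl; ≤-trans; ≤-reflexive; ≤-pred; <⇒≤; n≤1+n; m≤n+m; <-cmp; suc-injective;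
         0≢1+n; <⇒≢; pred-mono-≤; n≤0⇒n≡0; m≤n⇒m<n∨m≡n; +-monoʳ-≤; +-monoʳ-<; m∸n+n≡m)
open import Data.Fin using (Fin; zero; suc; toℕ; inject₁; fromℕ; fromℕ<; _≟_)
open import Data.Fin.Properties
  using (toℕ-injective; toℕ-inject₁; toℕ-fromℕ; toℕ-fromℕ<; toℕ<n)
  renaming (suc-injective to fsuc-injective; 0≢1+n to fzero≢fsuc)
open import Data.Bool using (Bool; true; false; if_then_else_)
open import Data.List using (tabulate)
open import Data.List.Properties using (map-tabulate)
open import Data.Nat.ListAction using (sum)
open import Data.Product using (Σ; _×_; _,_; proj₁; proj₂)
open import Data.Sum using (_⊎_; inj₁; inj₂; map₁; [_,_]′)
open import Data.Empty using (⊥-elim)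
open import Function using (id; _∘_)
open import Function.Bundles using (_⇔_; mk⇔)
open import Relation.Nullary using (¬_; Dec; yes; no)
open import Relation.Nullary.Decidable using (dec-true; dec-false)
open import Relation.Binary.PropositionalEquality
open import Relation.Binary.Definitions using (tri<; tri≈; tri>)
open import Relation.Binary.Construct.Closure.ReflexiveTransitive using (Star; ε; _◅_; _◅◅_)
import Relation.Binary.Construct.Closure.ReflexiveTransitive as Star

open ≡-Reasoning

module _ {n : ℕ} where

  elem-hit : (a b : Fin n) → elem a b a ≡ b
  elem-hit a b rewrite dec-true (a ≟ a) refl = refl

  elem-miss : (a b : Fin n) {x : Fin n} → x ≢ a → elem a b x ≡ x
  elem-miss a b {x} x≢a rewrite dec-false (x ≟ a) x≢a = refl

arc-irrefl : ∀ {n} (D : Digraph n) {a b : Fin n} → Arc D a b → a ≢ b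
arc-irrefl D {a} ab refl with () ← trans (sym (loopless D a)) ab

Functional : ∀ {n} → Digraph n → Set
Functional D = ∀ {a b c} → Arc D a b → Arc D a c → b ≡ c

count : ∀ {n} → (Fin n → Bool) → ℕ
count g = sum (tabulate (λ b → if g b then 1 else 0))

outDegree-count : ∀ {n} (D : Digraph n) a → outDegree D a ≡ count (arc D a)
outDegree-count D a = cong sum (map-tabulate id (λ b → if arc D a b then 1 else 0))

count-pos : ∀ {n} (g : Fin n → Bool) {c} → g c ≡ true → 1 ≤ count g
count-pos g {zero} gc rewrite gc = s≤s z≤n
count-pos g {suc c} gc = ≤-trans (count-pos (g ∘ suc) gc) (m≤n+m _ _)

count-none : ∀ {n} (g : Fin n → Bool) → (∀ {c} → g c ≢ true) → count g ≡ 0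
count-none {zero} g none = refl
count-none {suc n} g none with g zero in g₀
... | true = ⊥-elim (none g₀)
... | false = count-none (g ∘ suc) none

count-rest : ∀ {n} (g : Fin (suc n) → Bool) → g zero ≡ true → count g ≤ 1 → ∀ {c} → g (suc c) ≢ true
count-rest g g₀ le gc rewrite g₀ with () ← ≤-trans (count-pos (g ∘ suc) gc) (≤-pred le)

count≤1⇒unique : ∀ {n} (g : Fin n → Bool) → count g ≤ 1 →
                 ∀ {b c} → g b ≡ true → g c ≡ true → b ≡ c
count≤1⇒unique g le {zero}  {zero}  gb gc = refl
count≤1⇒unique g le {zero}  {suc c} gb gc = ⊥-elim (count-rest g gb le gc)
count≤1⇒unique g le {suc b} {zero}  gb gc = ⊥-elim (count-rest g gc le gb)
count≤1⇒unique g le {suc b} {suc c} gb gc =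
  cong suc (count≤1⇒unique (g ∘ suc) (≤-trans (m≤n+m _ _) le) gb gc)

unique⇒count≤1 : ∀ {n} (g : Fin n → Bool) →
                 (∀ {b c} → g b ≡ true → g c ≡ true → b ≡ c) → count g ≤ 1
unique⇒count≤1 {zero} g unique = z≤n
unique⇒count≤1 {suc n} g unique with g zero in g₀
... | true  = s≤s (≤-reflexive (count-none (g ∘ suc) (λ gc → fzero≢fsuc (unique g₀ gc))))
... | false = unique⇒count≤1 (g ∘ suc) (λ gb gc → fsuc-injective (unique gb gc))

module _ {n : ℕ} (D : Digraph n) where

  outDegree≤1⇒functional : (∀ a → outDegree D a ≤ 1) → Functional D
  outDegree≤1⇒functional deg {a} =
    count≤1⇒unique (arc D a) (subst (_≤ 1) (outDegree-count D a) (deg a))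

  functional⇒outDegree≤1 : Functional D → ∀ a → outDegree D a ≤ 1
  functional⇒outDegree≤1 functional a =
    subst (_≤ 1) (sym (outDegree-count D a)) (unique⇒count≤1 (arc D a) functional)

least? : {P : ℕ → Set} → (∀ k → Dec (P k)) → ∀ m →
         (Σ ℕ λ k → k < m × P k × (∀ j → j < k → ¬ P j)) ⊎ (∀ k → k < m → ¬ P k)
least? P? zero = inj₂ (λ _ ())
least? P? (suc m) with least? P? m
... | inj₁ (k , k<m , pk , below) = inj₁ (k , ≤-trans k<m (n≤1+n m) , pk , below)
... | inj₂ none with P? m
...   | yes pm = inj₁ (m , ≤-refl , pm , none)
...   | no ¬pm = inj₂ λ k k<1+m → [ none k , (λ { refl → ¬pm }) ]′ (m≤n⇒m<n∨m≡n (≤-pred k<1+m))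

module _ {A : Set} {T : A → A → Set} where

  -- The vertices visited by a path, indexed by ℕ (constant after the end).
  walk : ∀ {x y} → Star T x y → ℕ → A
  walk {x} _ zero = x
  walk {x} ε (suc i) = x
  walk (_ ◅ p) (suc i) = walk p i

  len : ∀ {x y} → Star T x y → ℕ
  len ε = 0
  len (_ ◅ p) = suc (len p)

  walk-end : ∀ {x y} (p : Star T x y) → walk p (len p) ≡ y
  walk-end ε = refl
  walk-end (_ ◅ p) = walk-end p

  walk-step : ∀ {x y} (p : Star T x y) → ∀ i → i < len p → T (walk p i) (walk p (suc i))
  walk-step (s ◅ p) zero _ = s
  walk-step (_ ◅ p) (suc i) i<len = walk-step p i (≤-pred i<len)

record IsCycle {n : ℕ} (D : Digraph n) (w : ℕ → Fin n) (r : ℕ) : Set where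
  field
    steps    : ∀ i → i < r → Arc D (w i) (w (suc i))
    closed   : w r ≡ w 0
    distinct : ∀ i j → i < r → j < r → w i ≡ w j → i ≡ j

module _ {n : ℕ} {D : Digraph n} where

  IsCycle⇒DirectedCycle : ∀ {w r} → IsCycle D w r → DirectedCycle D r
  IsCycle⇒DirectedCycle {w} {r} cyc = record
    { v        = λ i → w (toℕ i)
    ; arcs     = λ i → subst (λ k → Arc D (w k) (w (suc (toℕ i)))) (sym (toℕ-inject₁ i))
                             (steps (toℕ i) (toℕ<n i))
    ; closed   = trans (sym closed) (cong w (sym (toℕ-fromℕ r)))
    ; distinct = λ i j e → toℕ-injective
        (distinct (toℕ i) (toℕ j) (toℕ<n i) (toℕ<n j)
          (subst₂ (λ k l → w k ≡ w l) (toℕ-inject₁ i) (toℕ-inject₁ j) e))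
    }
    where open IsCycle cyc

  -- clamp r i is i as an element of Fin (suc r), capped at r.
  clamp : ∀ r → ℕ → Fin (suc r)
  clamp r       zero    = zero
  clamp zero    (suc i) = zero
  clamp (suc r) (suc i) = suc (clamp r i)

  clamp-inject : ∀ r i (i<r : i < r) → clamp r i ≡ inject₁ (fromℕ< i<r)
  clamp-inject (suc r) zero    _         = refl
  clamp-inject (suc r) (suc i) (s≤s i<r) = cong suc (clamp-inject r i i<r)

  clamp-suc : ∀ r i (i<r : i < r) → clamp r (suc i) ≡ suc (fromℕ< i<r)
  clamp-suc (suc r) zero    _         = refl
  clamp-suc (suc r) (suc i) (s≤s i<r) = cong suc (clamp-suc r i i<r)

  clamp-top : ∀ r → clamp r r ≡ fromℕ r
  clamp-top zero    = refl
  clamp-top (suc r) = cong suc (clamp-top r)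

  DirectedCycle⇒IsCycle : ∀ {r} (C : DirectedCycle D r) →
                          IsCycle D (λ i → DirectedCycle.v C (clamp r i)) r
  DirectedCycle⇒IsCycle {r} C = record
    { steps    = λ i i<r → subst₂ (λ k l → Arc D (v k) (v l))
                             (sym (clamp-inject r i i<r)) (sym (clamp-suc r i i<r)) (arcs (fromℕ< i<r))
    ; closed   = trans (cong v (clamp-top r)) (sym closed)
    ; distinct = λ i j i<r j<r e → begin
        i                    ≡⟨ sym (toℕ-fromℕ< i<r) ⟩
        toℕ (fromℕ< i<r)     ≡⟨ cong toℕ (distinct (fromℕ< i<r) (fromℕ< j<r)
                                  (subst₂ (λ k l → v k ≡ v l) (clamp-inject r i i<r) (clamp-inject r j j<r) e)) ⟩
        toℕ (fromℕ< j<r)     ≡⟨ toℕ-fromℕ< j<r ⟩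
        j                    ∎
    }
    where open DirectedCycle C

module _ {n : ℕ} (D : Digraph n) where

  -- (a→b)(a→c) = (a→b): after the first map nothing is left at a.
  absorb : ∀ {a b : Fin n} → b ≢ a → ∀ c → (elem a b · elem a c) ≈ elem a b
  absorb {a} {b} b≢a c x with x ≟ a
  ... | yes _   = elem-miss a c b≢a
  ... | no  x≢a = elem-miss a c x≢a

  generators-L : ∀ {a b c} → Arc D a b → Arc D a c → GreenL D (elem a b) (elem a c)
  generators-L {a} {b} {c} ab ac =
      inj₂ (elem a b , gen ab , λ x → sym (absorb (arc-irrefl D ab ∘ sym) c x))
    , inj₂ (elem a c , gen ac , λ x → sym (absorb (arc-irrefl D ac ∘ sym) b x))

  LTrivial⇒functional : LTrivial D → Functional D
  LTrivial⇒functional lt {a} {b} {c} ab ac = begin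
    b          ≡⟨ sym (elem-hit a b) ⟩
    elem a b a ≡⟨ lt _ _ (gen ab) (gen ac) (generators-L ab ac) a ⟩
    elem a c a ≡⟨ elem-hit a c ⟩
    c          ∎

-- collapse w k = (w₀→w₁)(w₁→w₂)⋯(w_k→w_{k+1}) drags w₀,…,w_k onto w_{k+1}.
collapse : ∀ {n} → (ℕ → Fin n) → ℕ → Trans n
collapse w zero    = elem (w 0) (w 1)
collapse w (suc k) = elem (w 0) (w 1) · collapse (w ∘ suc) k

Injective≤ : ∀ {n} → (ℕ → Fin n) → ℕ → Set
Injective≤ w m = ∀ {i j} → i ≤ m → j ≤ m → w i ≡ w j → i ≡ j

module _ {n : ℕ} where

  injective-suc : ∀ {w : ℕ → Fin n} {m} → Injective≤ w (suc m) → Injective≤ (w ∘ suc) m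
  injective-suc inj i≤m j≤m e = suc-injective (inj (s≤s i≤m) (s≤s j≤m) e)

  first-step : ∀ {w : ℕ → Fin n} {m} → Injective≤ w m → ∀ {j} → j ≤ m →
               elem (w 0) (w 1) (w j) ≡ w (suc (pred j))
  first-step {w} inj {zero}  _   = elem-hit (w 0) (w 1)
  first-step {w} inj {suc j} j≤m = elem-miss (w 0) (w 1) (λ e → 0≢1+n (sym (inj j≤m z≤n e)))

  collapse-hit : ∀ {w : ℕ → Fin n} k → Injective≤ w (suc k) → ∀ {j} → j ≤ suc k →
                 collapse w k (w j) ≡ w (suc k)
  collapse-hit {w} zero inj {j} j≤1 =
    trans (first-step inj j≤1) (cong (w ∘ suc) (n≤0⇒n≡0 (pred-mono-≤ j≤1)))
  collapse-hit {w} (suc k) inj {j} j≤ =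
    trans (cong (collapse (w ∘ suc) k) (first-step inj j≤))
          (collapse-hit k (injective-suc inj) (pred-mono-≤ j≤))

  collapse-miss : ∀ {w : ℕ → Fin n} k {x} → (∀ i → i ≤ k → x ≢ w i) → collapse w k x ≡ x
  collapse-miss {w} zero    off = elem-miss (w 0) (w 1) (off 0 z≤n)
  collapse-miss {w} (suc k) off =
    trans (cong (collapse (w ∘ suc) k) (elem-miss (w 0) (w 1) (off 0 z≤n)))
          (collapse-miss k (λ i i≤k → off (suc i) (s≤s i≤k)))

  collapse-∈ : ∀ (D : Digraph n) {w : ℕ → Fin n} k →
               (∀ i → i ≤ k → Arc D (w i) (w (suc i))) → ⟨ D ⟩∋ collapse w k
  collapse-∈ D zero    arcs = gen (arcs 0 z≤n)
  collapse-∈ D (suc k) arcs = comp (gen (arcs 0 z≤n)) (collapse-∈ D k (λ i i≤k → arcs (suc i) (s≤s i≤k)))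

-- A cycle w₀ → ⋯ → w_mid → w_top → w₀ of length q + 3.  With
--   s  = collapse of w₀,…,w_q onto w_mid     (fixes w_top),
--   up = collapse of w₁,…,w_mid onto w_top   (fixes w₀),
--   t  = up s   and   u = s (top→0)(mid→top)(0→1)(top→0),
-- t lies in S s and s = u t, yet s w₁ = w_mid ≠ w_top = t w₁.
module LongCycle {n : ℕ} (D : Digraph n) (q : ℕ) {w : ℕ → Fin n} (cyc : IsCycle D w (3 + q)) where
  open IsCycle cyc

  mid top : ℕ
  mid = suc q
  top = suc mid

  injective : Injective≤ w top
  injective i≤ j≤ = distinct _ _ (s≤s i≤) (s≤s j≤)

  apart : ∀ {i j} → i < j → j ≤ top → w i ≢ w j
  apart i<j j≤ e = <⇒≢ i<j (injective (≤-trans (<⇒≤ i<j) j≤) j≤ e)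

  arc-from : ∀ i → i ≤ top → Arc D (w i) (w (suc i))
  arc-from i i≤ = steps i (s≤s i≤)

  q≤top : q ≤ top
  q≤top = ≤-trans (n≤1+n q) (n≤1+n mid)

  top→0 mid→top 0→1 : Trans n
  top→0    = elem (w top) (w 0)
  mid→top = elem (w mid) (w top)
  0→1     = elem (w 0) (w 1)

  s up t u : Trans n
  s  = collapse w q
  up = collapse (w ∘ suc) q
  t  = up · s
  u  = (((s · top→0) · mid→top) · 0→1) · top→0

  s∈ : ⟨ D ⟩∋ s
  s∈ = collapse-∈ D q (λ i i≤q → arc-from i (≤-trans i≤q q≤top))

  up∈ : ⟨ D ⟩∋ up
  up∈ = collapse-∈ D q (λ i i≤q → arc-from (suc i) (s≤s (≤-trans i≤q (n≤1+n q))))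

  u∈ : ⟨ D ⟩∋ u
  u∈ = comp (comp (comp (comp s∈ top→0∈) (gen (arc-from mid (n≤1+n mid)))) (gen (arc-from 0 z≤n))) top→0∈
    where
    top→0∈ : ⟨ D ⟩∋ top→0
    top→0∈ = gen (subst (Arc D (w top)) closed (arc-from top ≤-refl))

  s-hit : ∀ {j} → j ≤ mid → s (w j) ≡ w mid
  s-hit = collapse-hit q (λ i≤ j≤ → injective (≤-trans i≤ (n≤1+n mid)) (≤-trans j≤ (n≤1+n mid)))

  s-top : s (w top) ≡ w top
  s-top = collapse-miss q (λ i i≤q → ≢-sym (apart (s≤s (≤-trans i≤q (n≤1+n q))) ≤-refl))

  s-off : ∀ {x} → (∀ i → i ≤ top → x ≢ w i) → s x ≡ x
  s-off off = collapse-miss q (λ i i≤q → off i (≤-trans i≤q q≤top))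

  up-hit : up (w 1) ≡ w top
  up-hit = collapse-hit q (injective-suc injective) z≤n

  up-w₀ : up (w 0) ≡ w 0
  up-w₀ = collapse-miss q (λ i i≤q → apart (s≤s z≤n) (s≤s (≤-trans i≤q (n≤1+n q))))

  up-off : ∀ {x} → (∀ i → i ≤ top → x ≢ w i) → up x ≡ x
  up-off off = collapse-miss q (λ i i≤q → off (suc i) (s≤s (≤-trans i≤q (n≤1+n q))))

  u-low : ∀ {j} → j ≤ mid → u (w j) ≡ w 0
  u-low {j} j≤ = begin
    top→0 (0→1 (mid→top (top→0 (s (w j))))) ≡⟨ cong (top→0 ∘ 0→1 ∘ mid→top ∘ top→0) (s-hit j≤) ⟩
    top→0 (0→1 (mid→top (top→0 (w mid))))   ≡⟨ cong (top→0 ∘ 0→1 ∘ mid→top) (elem-miss _ _ (apart ≤-refl ≤-refl)) ⟩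
    top→0 (0→1 (mid→top (w mid)))            ≡⟨ cong (top→0 ∘ 0→1) (elem-hit (w mid) (w top)) ⟩
    top→0 (0→1 (w top))                      ≡⟨ cong top→0 (elem-miss _ _ (≢-sym (apart (s≤s z≤n) ≤-refl))) ⟩
    top→0 (w top)                            ≡⟨ elem-hit (w top) (w 0) ⟩
    w 0                                      ∎

  u-top : u (w top) ≡ w 1
  u-top = begin
    top→0 (0→1 (mid→top (top→0 (s (w top))))) ≡⟨ cong (top→0 ∘ 0→1 ∘ mid→top ∘ top→0) s-top ⟩
    top→0 (0→1 (mid→top (top→0 (w top))))     ≡⟨ cong (top→0 ∘ 0→1 ∘ mid→top) (elem-hit (w top) (w 0)) ⟩
    top→0 (0→1 (mid→top (w 0)))               ≡⟨ cong (top→0 ∘ 0→1) (elem-miss _ _ (apart (s≤s z≤n) (n≤1+n mid))) ⟩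
    top→0 (0→1 (w 0))                         ≡⟨ cong top→0 (elem-hit (w 0) (w 1)) ⟩
    top→0 (w 1)                               ≡⟨ elem-miss _ _ (apart (s≤s (s≤s z≤n)) ≤-refl) ⟩
    w 1                                       ∎

  u-off : ∀ {x} → (∀ i → i ≤ top → x ≢ w i) → u x ≡ x
  u-off {x} off = begin
    top→0 (0→1 (mid→top (top→0 (s x)))) ≡⟨ cong (top→0 ∘ 0→1 ∘ mid→top ∘ top→0) (s-off off) ⟩
    top→0 (0→1 (mid→top (top→0 x)))     ≡⟨ cong (top→0 ∘ 0→1 ∘ mid→top) (elem-miss _ _ (off top ≤-refl)) ⟩
    top→0 (0→1 (mid→top x))             ≡⟨ cong (top→0 ∘ 0→1) (elem-miss _ _ (off mid (n≤1+n mid))) ⟩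
    top→0 (0→1 x)                       ≡⟨ cong top→0 (elem-miss _ _ (off 0 z≤n)) ⟩
    top→0 x                             ≡⟨ elem-miss _ _ (off top ≤-refl) ⟩
    x                                   ∎

  s≈ut : s ≈ (u · t)
  s≈ut x with least? (λ i → x ≟ w i) (suc top)
  ... | inj₂ off = begin
    s x          ≡⟨ cong s (sym (up-off off′)) ⟩
    s (up x)     ≡⟨ cong (s ∘ up) (sym (u-off off′)) ⟩
    s (up (u x)) ∎
    where
    off′ : ∀ i → i ≤ top → x ≢ w i
    off′ i i≤ = off i (s≤s i≤)
  ... | inj₁ (j , j<r , refl , _) with m≤n⇒m<n∨m≡n (≤-pred j<r)
  ...   | inj₁ j<top = begin
    s (w j)           ≡⟨ s-hit (≤-pred j<top) ⟩
    w mid             ≡⟨ sym (s-hit z≤n) ⟩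
    s (w 0)           ≡⟨ cong s (sym up-w₀) ⟩
    s (up (w 0))      ≡⟨ cong (s ∘ up) (sym (u-low (≤-pred j<top))) ⟩
    s (up (u (w j)))  ∎
  ...   | inj₂ refl = begin
    s (w top)          ≡⟨ cong s (sym up-hit) ⟩
    s (up (w 1))       ≡⟨ cong (s ∘ up) (sym u-top) ⟩
    s (up (u (w top))) ∎

  s-L-t : GreenL D s t
  s-L-t = inj₂ (u , u∈ , s≈ut) , inj₂ (up , up∈ , λ _ → refl)

  not-LTrivial : ¬ LTrivial D
  not-LTrivial lt = apart ≤-refl ≤-refl (begin
    w mid         ≡⟨ sym (s-hit (s≤s z≤n)) ⟩
    s (w 1)       ≡⟨ lt s t s∈ (comp up∈ s∈) s-L-t (w 1) ⟩
    s (up (w 1))  ≡⟨ cong s up-hit ⟩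
    s (w top)     ≡⟨ s-top ⟩
    w top         ∎)

LTrivial⇒noLongCycle : ∀ {n} (D : Digraph n) → LTrivial D → ∀ r → 2 < r → ¬ DirectedCycle D r
LTrivial⇒noLongCycle D lt (suc (suc (suc q))) (s≤s (s≤s (s≤s _))) C =
  LongCycle.not-LTrivial D q (DirectedCycle⇒IsCycle C) lt

module Sufficiency {n : ℕ} (D : Digraph n) (functional : Functional D)
                   (short : ∀ r → 2 < r → ¬ DirectedCycle D r) where

  Reach : Fin n → Fin n → Set
  Reach = Star (Arc D)

  -- Avoid z x y: a path from x to y that never leaves z, i.e. a path that
  -- visits z at most as its final vertex.
  Avoid : Fin n → Fin n → Fin n → Set
  Avoid z = Star (λ a b → a ≢ z × Arc D a b)

  avoid⇒reach : ∀ {z x y} → Avoid z x y → Reach x y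
  avoid⇒reach = Star.map proj₂

  first-visit : ∀ {x y} → Reach x y → Avoid y x y
  first-visit ε = ε
  first-visit {x} {y} (xc ◅ p) with x ≟ y
  ... | yes refl = ε
  ... | no  x≢y  = (x≢y , xc) ◅ first-visit p

  avoid-self : ∀ {a y} → Avoid a a y → y ≡ a
  avoid-self ε = refl
  avoid-self ((a≢a , _) ◅ _) = ⊥-elim (a≢a refl)

  divert : ∀ {a x y} b → Avoid a x y → Avoid b x y ⊎ Avoid a b y
  divert b ε = inj₁ ε
  divert {x = x} b (s ◅ p) with x ≟ b
  ... | yes refl = inj₂ (s ◅ p)
  ... | no  x≢b  = map₁ ((x≢b , proj₂ s) ◅_) (divert b p)

  advance : ∀ {a b z} → Arc D a b → a ≢ z → Reach a z → Reach b z
  advance ab a≢z ε = ⊥-elim (a≢z refl)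
  advance ab a≢z (ac ◅ p) with functional ab ac
  ... | refl = p

  -- Walks are determined by their start: the walk from x cannot reach y
  -- strictly before z and z strictly before y.
  first-visit-antisym : ∀ {x y z} → Avoid z x y → Avoid y x z → y ≡ z
  first-visit-antisym ε ε = refl
  first-visit-antisym ε ((x≢x , _) ◅ _) = ⊥-elim (x≢x refl)
  first-visit-antisym ((x≢x , _) ◅ _) ε = ⊥-elim (x≢x refl)
  first-visit-antisym ((_ , xc) ◅ p) ((_ , xd) ◅ p′) with functional xc xd
  ... | refl = first-visit-antisym p p′

  forward : ∀ {f} → ⟨ D ⟩∋ f → ∀ x → Reach x (f x)
  forward (gen {a} ab) x with x ≟ a
  ... | yes refl = ab ◅ ε
  ... | no  _    = ε
  forward (comp {f} pf pg) x = forward pf x ◅◅ forward pg (f x)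
  forward (resp f≈g pf) x = subst (Reach x) (f≈g x) (forward pf x)

  revisit : ∀ {w : ℕ → Fin n} {L} → (∀ i → i < L → Arc D (w i) (w (suc i))) →
            ∀ {i j} → i ≤ j → w i ≡ w j → ∀ t → t + j ≤ L → w (t + i) ≡ w (t + j)
  revisit steps i≤j e zero _ = e
  revisit {w} steps {i} {j} i≤j e (suc t) t+j<L =
    functional (steps (t + i) (≤-trans (s≤s (+-monoʳ-≤ t i≤j)) t+j<L))
               (subst (λ v → Arc D v (w (suc (t + j))))
                      (sym (revisit steps i≤j e t (<⇒≤ t+j<L))) (steps (t + j) t+j<L))

  first-return : ∀ {x y} (xy : Arc D x y) (p : Reach y x) →
                 Σ ℕ λ m → m ≤ len p × IsCycle D (walk (xy ◅ p)) (suc m)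
  first-return {x} xy p with least? (λ k → walk (xy ◅ p) (suc k) ≟ x) (suc (len p))
  ... | inj₂ none = ⊥-elim (none (len p) ≤-refl (walk-end p))
  ... | inj₁ (m , m<L , returns , earlier) = m , ≤-pred m<L , record
    { steps    = λ i i≤m → walk-step (xy ◅ p) i (≤-trans i≤m m<L)
    ; closed   = returns
    ; distinct = distinct
    }
    where
    w : ℕ → Fin n
    w = walk (xy ◅ p)

    -- a repetition w i = w j with i < j ≤ m would give an earlier return
    no-repeat : ∀ {i j} → i < j → j ≤ m → w i ≢ w j
    no-repeat {i} {j} i<j j≤m e = earlier (m ∸ j + i) early (begin
      w (suc (m ∸ j + i)) ≡⟨ revisit (walk-step (xy ◅ p)) (<⇒≤ i<j) e (suc (m ∸ j))
                               (subst (_≤ suc (len p)) (sym (cong suc m∸j+j)) m<L) ⟩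
      w (suc (m ∸ j + j)) ≡⟨ cong (w ∘ suc) m∸j+j ⟩
      w (suc m)           ≡⟨ returns ⟩
      x                   ∎)
      where
      m∸j+j : m ∸ j + j ≡ m
      m∸j+j = m∸n+n≡m j≤m
      early : m ∸ j + i < m
      early = subst (m ∸ j + i <_) m∸j+j (+-monoʳ-< (m ∸ j) i<j)

    distinct : ∀ i j → i < suc m → j < suc m → w i ≡ w j → i ≡ j
    distinct i j i<1+m j<1+m e with <-cmp i j
    ... | tri< i<j _ _ = ⊥-elim (no-repeat i<j (≤-pred j<1+m) e)
    ... | tri≈ _ i≡j _ = i≡j
    ... | tri> _ _ j<i = ⊥-elim (no-repeat j<i (≤-pred i<1+m) (sym e))

  -- Without long cycles, a closed walk through an arc a → b is the 2-cycle a ⇄ b.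
  return-arc : ∀ {a b} → Arc D a b → Reach b a → Arc D b a
  return-arc ab p with first-return ab p
  ... | zero , _ , cyc = ⊥-elim (arc-irrefl D ab (sym (IsCycle.closed cyc)))
  ... | suc zero , _ , cyc = subst (Arc D _) (IsCycle.closed cyc) (IsCycle.steps cyc 1 ≤-refl)
  ... | suc (suc m) , _ , cyc = ⊥-elim (short (3 + m) (s≤s (s≤s (s≤s z≤n))) (IsCycle⇒DirectedCycle cyc))

  trapped : ∀ {a b y} → Arc D b a → Avoid a b y → y ≢ a → y ≡ b
  trapped ba ε _ = refl
  trapped ba ((_ , bc) ◅ p) y≢a with functional bc ba
  ... | refl = ⊥-elim (y≢a (avoid-self p))

  -- If the walk from x reaches y before a, and y ⇝ a → b, it reaches y
  -- before b; passing through b first would close the 2-cycle a ⇄ b.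
  before-successor : ∀ {a b x y} → Arc D a b → y ≢ a → Avoid a x y → Reach y a → Avoid b x y
  before-successor {a} {b} {x} {y} ab y≢a xy ya with divert b xy
  ... | inj₁ xy′ = xy′
  ... | inj₂ by  = subst (Avoid b x) (sym y≡b) (first-visit (avoid⇒reach xy ◅◅ ya ◅◅ (ab ◅ ε)))
    where
    y≡b : y ≡ b
    y≡b = trapped (return-arc ab (avoid⇒reach by ◅◅ ya)) by y≢a

  -- y ≼[ x ] z: the walk from x visits y no later than z, and goes on to z.
  _≼[_]_ : Fin n → Fin n → Fin n → Set
  y ≼[ x ] z = Avoid z x y × Reach y z

  ≼-elem : ∀ {a b x y z} → Arc D a b → y ≼[ x ] z → elem a b y ≼[ x ] elem a b z
  ≼-elem {a} {y = y} {z} ab (xy , yz) with y ≟ a | z ≟ a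
  ... | yes refl | yes refl = first-visit (avoid⇒reach xy ◅◅ (ab ◅ ε)) , ε
  ... | yes refl | no  z≢a  = xy ◅◅ ((≢-sym z≢a , ab) ◅ ε) , advance ab (≢-sym z≢a) yz
  ... | no  y≢a  | yes refl = before-successor ab y≢a xy yz , yz ◅◅ (ab ◅ ε)
  ... | no  _    | no  _    = xy , yz

  ≼-mono : ∀ {f x y z} → ⟨ D ⟩∋ f → y ≼[ x ] z → f y ≼[ x ] f z
  ≼-mono (gen ab) = ≼-elem ab
  ≼-mono (comp pf pg) y≼z = ≼-mono pg (≼-mono pf y≼z)
  ≼-mono {x = x} {y} {z} (resp f≈g pf) y≼z =
    subst₂ (λ a b → a ≼[ x ] b) (f≈g y) (f≈g z) (≼-mono pf y≼z)

  left-ideal-later : ∀ {s t} → ⟨ D ⟩∋ t → InLeftIdeal¹ D s t → ∀ x → Avoid (s x) x (t x)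
  left-ideal-later {s} {t} t∈ (inj₁ s≈t) x =
    subst (λ z → Avoid z x (t x)) (sym (s≈t x)) (first-visit (forward t∈ x))
  left-ideal-later {s} {t} t∈ (inj₂ (u , u∈ , s≈ut)) x =
    subst (λ z → Avoid z x (t x)) (sym (s≈ut x)) (proj₁ (≼-mono t∈ (ε , forward u∈ x)))

  L-trivial : LTrivial D
  L-trivial s t s∈ t∈ (s∈S¹t , t∈S¹s) x =
    first-visit-antisym (left-ideal-later s∈ t∈S¹s x) (left-ideal-later t∈ s∈S¹t x)

proposition4p4 : ∀ {n : ℕ} (D : Digraph n) →
    LTrivial D ⇔ ((∀ (a : Fin n) → outDegree D a ≤ 1) × (∀ (r : ℕ) → 2 < r → ¬ DirectedCycle D r))
proposition4p4 D = mk⇔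
  (λ lt → functional⇒outDegree≤1 D (LTrivial⇒functional D lt) , LTrivial⇒noLongCycle D lt)
  (λ (deg , short) → Sufficiency.L-trivial D (outDegree≤1⇒functional D deg) short)
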